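{- Consider RLS on a fixed graph with current solution $s_t$ at iteration $t$ that violates no constraint and has $k$ uncovered edges. Then the drift on $G$ satisfies $E[G_t-G_{t+1}\mid G_t]\ge \frac{k}{2m}$.
   Context: Weighted vertex cover dual: graph $G=(V,E)$ with $E=\{e_1,\dots,e_m\}$, vertex weights $w:V\to\mathbb{N}^+$, $W_{tot}=\sum_v w(v)$. A solution is $s\in\mathbb{N}_0^m$; constraint of $v$: $\sum_{j:v\in e_j}s_j\le w(v)$. A node is tight if equality holds; $V_C(s)$ is the set of tight nodes; an edge is uncovered if neither endpoint is tight. A feasible solution is maximal if no edge weight can be increased by $1$ without violating a constraint. Let $W(s)=\sum_j s_j$, let $M_s$ be the set of maximal solutions obtainable from $s$ only by increasing edge weights, and $G(s)=\max_{o\in M_s}\{W(o)-W(s)\}$; $G_t$ is $G$ of the solution at iteration $t$. Fitness (maximised): $f(s)=W(s)-(W_{tot}+1)\cdot|\{e\mid e\cap V_C(s)=\emptyset\}|-(m+1)(W_{tot}+1)\cdot|\{v\mid\sum_{j:v\in e_j}s_j>w(v)\}|$. RLS: each iteration choose $i$ uniformly at random and with probability $1/2$ each set $s'_i=s_i+1$ or $s'_i=\max\{s_i-1,0\}$; accept iff $f(s')>f(s)$. -}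

module Defs where

open import Data.Nat using (ℕ; zero; suc; _+_; _*_; _∸_; _≤_; _≤?_; _⊔_)
open import Data.Nat.Properties using () renaming (_≟_ to _≟ℕ_)
open import Data.Integer as ℤ using (ℤ; +_; _<?_)
open import Data.Fin using (Fin) renaming (_≟_ to _≟ᶠ_)
open import Data.Fin.Properties using (all?)
open import Data.Bool using (Bool; true; false; if_then_else_; _∨_)
open import Data.Nat.ListAction using (sum)
open import Data.List using (List; []; _∷_; map; allFin; upTo; concatMap; filter; foldr)
open import Data.Product using (_×_; _,_; proj₁; proj₂)
open import Data.Sum using (_⊎_)
open import Data.Vec.Functional using () renaming (_∷_ to _∷ᶠ_)
open import Relation.Nullary using (¬_; Dec; ¬?; does; _×-dec_)
open import Relation.Binary.PropositionalEquality using (_≡_; _≢_)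

-- A (finite simple) graph with vertices Fin n and edges e_0 … e_{m-1},
-- edge j = {endA j , endB j}, together with positive integer vertex weights.
record Instance : Set where
  field
    n m   : ℕ
    endA  : Fin m → Fin n
    endB  : Fin m → Fin n
    w     : Fin n → ℕ
    w-pos : ∀ v → 1 ≤ w v
    simple   : ∀ j → endA j ≢ endB j
    distinct : ∀ i j → i ≢ j →
               ¬ ((endA i ≡ endA j × endB i ≡ endB j) ⊎ (endA i ≡ endB j × endB i ≡ endA j))

module _ (I : Instance) where
  open Instance I

  Sol : Set
  Sol = Fin m → ℕ

  Σᶠ : ∀ {k} → (Fin k → ℕ) → ℕ
  Σᶠ {k} f = sum (map f (allFin k))

  Wtot : ℕ
  Wtot = Σᶠ w

  W : Sol → ℕ
  W s = Σᶠ s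

  incident : Fin n → Fin m → Bool
  incident v j = does (v ≟ᶠ endA j) ∨ does (v ≟ᶠ endB j)

  load : Sol → Fin n → ℕ
  load s v = Σᶠ (λ j → if incident v j then s j else 0)

  Tight : Sol → Fin n → Set
  Tight s v = load s v ≡ w v

  tight? : (s : Sol) (v : Fin n) → Dec (Tight s v)
  tight? s v = load s v ≟ℕ w v

  uncovered : Sol → ℕ
  uncovered s = Σᶠ (λ j → if does (tight? s (endA j)) ∨ does (tight? s (endB j)) then 0 else 1)

  violated : Sol → ℕ
  violated s = Σᶠ (λ v → if does (load s v ≤? w v) then 0 else 1)

  Feasible : Sol → Set
  Feasible s = ∀ v → load s v ≤ w v

  feasible? : (s : Sol) → Dec (Feasible s)
  feasible? s = all? (λ v → load s v ≤? w v)

  setAt : Sol → Fin m → ℕ → Sol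
  setAt s i x j = if does (j ≟ᶠ i) then x else s j

  inc dec : Sol → Fin m → Sol
  inc s i = setAt s i (suc (s i))
  dec s i = setAt s i (s i ∸ 1)

  Maximal : Sol → Set
  Maximal o = Feasible o × (∀ j → ¬ Feasible (inc o j))

  maximal? : (o : Sol) → Dec (Maximal o)
  maximal? o = feasible? o ×-dec all? (λ j → ¬? (feasible? (inc o j)))

  _≼_ : Sol → Sol → Set
  s ≼ o = ∀ j → s j ≤ o j

  ≼? : (s o : Sol) → Dec (s ≼ o)
  ≼? s o = all? (λ j → s j ≤? o j)

  allVecs : (k b : ℕ) → List (Fin k → ℕ)
  allVecs zero    b = (λ ()) ∷ []
  allVecs (suc k) b = concatMap (λ x → map (λ f → x ∷ᶠ f) (allVecs k b)) (upTo (suc b))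

  -- M_s : maximal solutions reachable from s by increases only.  Every feasible
  -- solution has all entries ≤ w(endA j) ≤ Wtot, so enumerating {0..Wtot}^m is complete.
  M : Sol → List Sol
  M s = filter (λ o → ≼? s o ×-dec maximal? o) (allVecs m Wtot)

  -- G(s) = max_{o ∈ M_s} (W(o) − W(s))   (M_s ≠ ∅ for feasible s)
  G : Sol → ℕ
  G s = foldr (λ o acc → (W o ∸ W s) ⊔ acc) 0 (M s)

  fitness : Sol → ℤ
  fitness s = + W s ℤ.- (+ (suc Wtot) ℤ.* + uncovered s)
                    ℤ.- (+ (suc m) ℤ.* + (suc Wtot) ℤ.* + violated s)

  select : Sol → Sol → Sol
  select s s' = if does (fitness s <? fitness s') then s' else s

  -- Σ over the 2m equally likely outcomes (i, ±) of (G_t − G_{t+1});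
  -- the expected drift equals this sum divided by 2m.
  driftSum : Sol → ℤ
  driftSum s = sum' (map (λ i → (+ G s ℤ.- + G (select s (inc s i)))
                              ℤ.+ (+ G s ℤ.- + G (select s (dec s i)))) (allFin m))
    where
      sum' : List ℤ → ℤ
      sum' = foldr ℤ._+_ (+ 0)

module Submission where

-- For each edge i the sum driftSum collects the two outcomes "increment s_i"
-- and "decrement s_i".  The proof shows, edge by edge, that these two
-- outcomes together decrease G by at least 1 when e_i is uncovered and by at
-- least 0 otherwise; summing over the edges gives the claim.
--
-- It then shows that below a
-- feasible solution the fitness is monotone in the pointwise order (so
-- decrements are always rejected) and that G is antitone in it.  The key
-- fact is that every feasible solution lies below a maximal one in the
-- enumeration defining M; hence if s ≼ s' with W(s) < W(s') and s' feasible,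
-- then G(s') < G(s).  Incrementing an uncovered edge keeps feasibility and
-- strictly increases fitness, so it is accepted and G drops.

open import Defs
open import Data.Integer using (+_; _≤_)
open import Data.Integer as ℤ using (ℤ; _<_; +≤+; _<?_)
import Data.Integer.Properties as ℤP
open import Data.Nat as ℕ using (ℕ; zero; suc; _+_; _∸_; _⊔_; z≤n; _≤?_) renaming (_≤_ to _≤ₙ_; _<_ to _<ₙ_)
import Data.Nat.Properties as ℕP
open import Data.Fin as Fin using (Fin) renaming (_≟_ to _≟ᶠ_)
open import Data.Fin.Properties using (suc-injective)
open import Data.Bool using (true; false; if_then_else_; _∨_)
open import Data.Nat.ListAction using (sum)
open import Data.List using (List; []; _∷_; map; tabulate; allFin; filter; foldr)
open import Data.List.Properties using (map-tabulate)
open import Data.List.Membership.Propositional using (_∈_; lose)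
open import Data.List.Membership.Propositional.Properties using (∈-map⁺; ∈-concatMap⁺; ∈-upTo⁺; ∈-filter⁺; ∈-filter⁻)
open import Data.List.Relation.Unary.Any using (here; there)
import Data.List.Relation.Unary.All as All
open import Data.List.Extrema.Nat using (argmax; argmax-sel; f[xs]≤f[argmax])
open import Data.Vec.Functional using () renaming (_∷_ to _∷ᶠ_)
open import Data.Product using (∃; _×_; _,_; proj₁; proj₂)
open import Data.Sum using (inj₁; inj₂)
open import Function using (id; _∘_)
open import Relation.Nullary using (Dec; yes; no; does; ¬_; _×-dec_; contradiction)
open import Relation.Nullary.Decidable using (dec-true; dec-false)
open import Relation.Binary.PropositionalEquality using (_≡_; _≢_; _≗_; refl; sym; trans; cong; cong₂; subst; module ≡-Reasoning)

∑ : ∀ {k} → (Fin k → ℕ) → ℕ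
∑ {k} f = sum (map f (allFin k))

∑ℤ : ∀ {k} → (Fin k → ℤ) → ℤ
∑ℤ {k} f = foldr ℤ._+_ (+ 0) (map f (allFin k))

map-allFin-suc : ∀ {A : Set} {k} (f : Fin (suc k) → A) →
                 map f (allFin (suc k)) ≡ f Fin.zero ∷ map (f ∘ Fin.suc) (allFin k)
map-allFin-suc {k = k} f = cong (f Fin.zero ∷_) (begin
  map f (tabulate Fin.suc)   ≡⟨ map-tabulate Fin.suc f ⟩
  tabulate (f ∘ Fin.suc)     ≡⟨ map-tabulate id (f ∘ Fin.suc) ⟨
  map (f ∘ Fin.suc) (allFin k) ∎)
  where open ≡-Reasoning

∑-suc : ∀ {k} (f : Fin (suc k) → ℕ) → ∑ f ≡ f Fin.zero + ∑ (f ∘ Fin.suc)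
∑-suc f = cong sum (map-allFin-suc f)

∑-mono : ∀ {k} {f g : Fin k → ℕ} → (∀ j → f j ≤ₙ g j) → ∑ f ≤ₙ ∑ g
∑-mono {zero}  f≤g = z≤n
∑-mono {suc k} {f} {g} f≤g rewrite ∑-suc f | ∑-suc g =
  ℕP.+-mono-≤ (f≤g Fin.zero) (∑-mono (f≤g ∘ Fin.suc))

∑-mono-< : ∀ {k} {f g : Fin k → ℕ} → (∀ j → f j ≤ₙ g j) → ∀ i → f i <ₙ g i → ∑ f <ₙ ∑ g
∑-mono-< {suc k} {f} {g} f≤g Fin.zero fi<gi rewrite ∑-suc f | ∑-suc g =
  ℕP.+-mono-<-≤ fi<gi (∑-mono (f≤g ∘ Fin.suc))
∑-mono-< {suc k} {f} {g} f≤g (Fin.suc i) fi<gi rewrite ∑-suc f | ∑-suc g =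
  ℕP.+-mono-≤-< (f≤g Fin.zero) (∑-mono-< (f≤g ∘ Fin.suc) i fi<gi)

∑-bump : ∀ {k} {f g : Fin k → ℕ} (i : Fin k) →
         (∀ j → j ≢ i → f j ≤ₙ g j) → f i ≤ₙ suc (g i) → ∑ f ≤ₙ suc (∑ g)
∑-bump {suc k} {f} {g} Fin.zero off at rewrite ∑-suc f | ∑-suc g =
  ℕP.+-mono-≤ at (∑-mono (λ j → off (Fin.suc j) (λ ())))
∑-bump {suc k} {f} {g} (Fin.suc i) off at rewrite ∑-suc f | ∑-suc g | sym (ℕP.+-suc (g Fin.zero) (∑ (g ∘ Fin.suc))) =
  ℕP.+-mono-≤ (off Fin.zero (λ ())) (∑-bump i (λ j j≢i → off (Fin.suc j) (j≢i ∘ suc-injective)) at)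

∑-single : ∀ {k} (f : Fin k → ℕ) (i : Fin k) → f i ≤ₙ ∑ f
∑-single f Fin.zero rewrite ∑-suc f = ℕP.m≤m+n (f Fin.zero) _
∑-single f (Fin.suc i) rewrite ∑-suc f = ℕP.≤-trans (∑-single (f ∘ Fin.suc) i) (ℕP.m≤n+m _ (f Fin.zero))

∑-≤-∑ℤ : ∀ {k} {u : Fin k → ℕ} {t : Fin k → ℤ} → (∀ j → + u j ≤ t j) → + ∑ u ≤ ∑ℤ t
∑-≤-∑ℤ {zero}  _ = +≤+ z≤n
∑-≤-∑ℤ {suc k} {u} {t} u≤t = begin
  + ∑ u                                        ≡⟨ cong +_ (∑-suc u) ⟩
  + (u Fin.zero + ∑ (u ∘ Fin.suc))             ≡⟨ ℤP.pos-+ (u Fin.zero) (∑ (u ∘ Fin.suc)) ⟩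
  + u Fin.zero ℤ.+ + ∑ (u ∘ Fin.suc)           ≤⟨ ℤP.+-mono-≤ (u≤t Fin.zero) (∑-≤-∑ℤ (u≤t ∘ Fin.suc)) ⟩
  t Fin.zero ℤ.+ ∑ℤ (t ∘ Fin.suc)              ≡⟨ cong (foldr ℤ._+_ (+ 0)) (map-allFin-suc t) ⟨
  ∑ℤ t                                         ∎
  where open ℤP.≤-Reasoning

maxOf : ∀ {A : Set} → (A → ℕ) → List A → ℕ
maxOf f = foldr (λ x acc → f x ⊔ acc) 0

maxOf-upper : ∀ {A : Set} (f : A → ℕ) {x xs} → x ∈ xs → f x ≤ₙ maxOf f xs
maxOf-upper f {xs = y ∷ _} (here refl) = ℕP.m≤m⊔n (f y) _
maxOf-upper f {xs = y ∷ _} (there x∈)  = ℕP.m≤n⇒m≤o⊔n (f y) (maxOf-upper f x∈)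

maxOf-preserves : ∀ {A : Set} (P : ℕ → Set) (f : A → ℕ) →
                  (∀ {a b} → P a → P b → P (a ⊔ b)) → P 0 →
                  ∀ xs → (∀ x → x ∈ xs → P (f x)) → P (maxOf f xs)
maxOf-preserves P f closed P0 []       Pf = P0
maxOf-preserves P f closed P0 (x ∷ xs) Pf =
  closed (Pf x (here refl)) (maxOf-preserves P f closed P0 xs (λ y y∈ → Pf y (there y∈)))

penalised-mono : ∀ {a a' b b' c c'} → a ≤ a' → b' ≤ b → c' ≤ c →
                 a ℤ.- b ℤ.- c ≤ a' ℤ.- b' ℤ.- c'
penalised-mono a≤ b≤ c≤ = ℤP.+-mono-≤ (ℤP.+-mono-≤ a≤ (ℤP.neg-mono-≤ b≤)) (ℤP.neg-mono-≤ c≤)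

penalised-mono-< : ∀ {a a' b b' c c'} → a < a' → b' ≤ b → c' ≤ c →
                   a ℤ.- b ℤ.- c < a' ℤ.- b' ℤ.- c'
penalised-mono-< a< b≤ c≤ = ℤP.+-mono-<-≤ (ℤP.+-mono-<-≤ a< (ℤP.neg-mono-≤ b≤)) (ℤP.neg-mono-≤ c≤)

pos-∸ : ∀ {a b} → b ≤ₙ a → + a ℤ.- + b ≡ + (a ∸ b)
pos-∸ {a} {b} b≤a = trans (ℤP.m-n≡m⊖n a b) (ℤP.⊖-≥ b≤a)

neither-antitone : ∀ {P Q P' Q' : Set} (p : Dec P) (q : Dec Q) (p' : Dec P') (q' : Dec Q') →
                   (P → P') → (Q → Q') →
                   (if does p' ∨ does q' then 0 else 1) ≤ₙ (if does p ∨ does q then 0 else 1)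
neither-antitone _       _       (yes _)  _        _   _   = z≤n
neither-antitone _       _       (no _)   (yes _)  _   _   = z≤n
neither-antitone (no _)  (no _)  (no _)   (no _)   _   _   = ℕP.≤-refl
neither-antitone (yes p) _       (no ¬p') (no _)   p⇒p' _   = contradiction (p⇒p' p) ¬p'
neither-antitone (no _)  (yes q) (no _)   (no ¬q') _   q⇒q' = contradiction (q⇒q' q) ¬q'

neither-bound : ∀ {P Q : Set} {n} (p : Dec P) (q : Dec Q) →
                (¬ P → ¬ Q → 1 ≤ₙ n) → (if does p ∨ does q then 0 else 1) ≤ₙ n
neither-bound (yes _) _       _ = z≤n
neither-bound (no _)  (yes _) _ = z≤n
neither-bound (no ¬p) (no ¬q) h = h ¬p ¬q

module _ (I : Instance) where
  open Instance I

  setAt-same : ∀ s i x → setAt I s i x i ≡ x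
  setAt-same s i x = cong (λ b → if b then x else s i) (dec-true (i ≟ᶠ i) refl)

  setAt-other : ∀ s i x {j} → j ≢ i → setAt I s i x j ≡ s j
  setAt-other s i x {j} j≢i = cong (λ b → if b then x else s j) (dec-false (j ≟ᶠ i) j≢i)

  inc-above : ∀ s i → _≼_ I s (inc I s i)
  inc-above s i j with j ≟ᶠ i
  ... | yes refl = ℕP.n≤1+n (s i)
  ... | no _     = ℕP.≤-refl

  dec-below : ∀ s i → _≼_ I (dec I s i) s
  dec-below s i j with j ≟ᶠ i
  ... | yes refl = ℕP.m∸n≤m (s i) 1
  ... | no _     = ℕP.≤-refl

  W-inc : ∀ s i → W I s <ₙ W I (inc I s i)
  W-inc s i = ∑-mono-< (inc-above s i) i (ℕP.≤-reflexive (sym (setAt-same s i (suc (s i)))))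

  ≼-trans : ∀ {r s t} → _≼_ I r s → _≼_ I s t → _≼_ I r t
  ≼-trans r≼s s≼t j = ℕP.≤-trans (r≼s j) (s≼t j)

  ≗⇒≼ : ∀ {s t} → s ≗ t → _≼_ I s t
  ≗⇒≼ s≗t = ℕP.≤-reflexive ∘ s≗t


  load-mono : ∀ {t s} → _≼_ I t s → ∀ v → load I t v ≤ₙ load I s v
  load-mono t≼s v = ∑-mono (λ j → mask (incident I v j) (t≼s j))
    where
      mask : ∀ b {x y} → x ≤ₙ y → (if b then x else 0) ≤ₙ (if b then y else 0)
      mask true  x≤y = x≤y
      mask false _   = z≤n

  feasible-down : ∀ {t s} → _≼_ I t s → Feasible I s → Feasible I t
  feasible-down t≼s fs v = ℕP.≤-trans (load-mono t≼s v) (fs v)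

  tight-up : ∀ {t s} → _≼_ I t s → Feasible I s → ∀ v → Tight I t v → Tight I s v
  tight-up t≼s fs v tight = ℕP.≤-antisym (fs v) (subst (_≤ₙ load I _ v) tight (load-mono t≼s v))

  uncovered-anti : ∀ {t s} → _≼_ I t s → Feasible I s → uncovered I s ≤ₙ uncovered I t
  uncovered-anti {t} {s} t≼s fs = ∑-mono λ j →
    neither-antitone (tight? I t (endA j)) (tight? I t (endB j))
                     (tight? I s (endA j)) (tight? I s (endB j))
                     (tight-up t≼s fs (endA j)) (tight-up t≼s fs (endB j))

  violated-least : ∀ {s} → Feasible I s → ∀ t → violated I s ≤ₙ violated I t
  violated-least {s} fs t = ∑-mono λ v →
    subst (λ b → (if b then 0 else 1) ≤ₙ _) (sym (dec-true (load I s v ≤? w v) (fs v))) z≤n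

  penalties-anti : ∀ {t s} → _≼_ I t s → Feasible I s →
                   + suc (Wtot I) ℤ.* + uncovered I s ≤ + suc (Wtot I) ℤ.* + uncovered I t ×
                   + suc m ℤ.* + suc (Wtot I) ℤ.* + violated I s ≤ + suc m ℤ.* + suc (Wtot I) ℤ.* + violated I t
  penalties-anti {t} t≼s fs =
    ℤP.*-monoˡ-≤-nonNeg (+ suc (Wtot I)) (+≤+ (uncovered-anti t≼s fs)) ,
    ℤP.*-monoˡ-≤-nonNeg (+ suc m ℤ.* + suc (Wtot I)) (+≤+ (violated-least fs t))

  fitness-mono : ∀ {t s} → _≼_ I t s → Feasible I s → fitness I t ≤ fitness I s
  fitness-mono t≼s fs = let unc , viol = penalties-anti t≼s fs in
    penalised-mono (+≤+ (∑-mono t≼s)) unc viol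

  fitness-mono-< : ∀ {t s} → _≼_ I t s → Feasible I s → W I t <ₙ W I s → fitness I t < fitness I s
  fitness-mono-< t≼s fs Wt<Ws = let unc , viol = penalties-anti t≼s fs in
    penalised-mono-< (ℤ.+<+ Wt<Ws) unc viol

  allVecs-complete : ∀ k b (o : Fin k → ℕ) → (∀ j → o j ≤ₙ b) →
                     ∃ λ o' → o' ∈ allVecs I k b × o' ≗ o
  allVecs-complete zero    b o _ = (λ ()) , here refl , (λ ())
  allVecs-complete (suc k) b o o≤b with allVecs-complete k b (o ∘ Fin.suc) (o≤b ∘ Fin.suc)
  ... | o' , o'∈ , o'≗ = (o Fin.zero ∷ᶠ o') ,
        ∈-concatMap⁺ (λ x → map (x ∷ᶠ_) (allVecs I k b)) (lose (∈-upTo⁺ (ℕ.s≤s (o≤b Fin.zero))) (∈-map⁺ (o Fin.zero ∷ᶠ_) o'∈)) ,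
        λ { Fin.zero → refl ; (Fin.suc j) → o'≗ j }

  -- An edge weight is part of the load of its endpoint endA, hence bounded by Wtot.
  feasible-bounded : ∀ {s} → Feasible I s → ∀ j → s j ≤ₙ Wtot I
  feasible-bounded {s} fs j = begin
    s j                     ≡⟨ cong (λ b → if b then s j else 0) endA-incident ⟨
    (if incident I (endA j) j then s j else 0) ≤⟨ ∑-single _ j ⟩
    load I s (endA j)       ≤⟨ fs (endA j) ⟩
    w (endA j)              ≤⟨ ∑-single w (endA j) ⟩
    Wtot I                  ∎
    where
      open ℕP.≤-Reasoning
      endA-incident : incident I (endA j) j ≡ true
      endA-incident = cong (_∨ does (endA j ≟ᶠ endB j)) (dec-true (endA j ≟ᶠ endA j) refl)

  enumerated : ∀ {s} → Feasible I s → ∃ λ s' → s' ∈ allVecs I m (Wtot I) × s' ≗ s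
  enumerated {s} fs = allVecs-complete m (Wtot I) s (feasible-bounded fs)

  -- Every feasible solution lies below a maximal solution of the enumeration:
  -- take one of largest W among the enumerated feasible solutions above s.
  maximal-above : ∀ {s} → Feasible I s →
                  ∃ λ o → o ∈ allVecs I m (Wtot I) × _≼_ I s o × Maximal I o
  maximal-above {s} fs with enumerated fs
  ... | d , d∈ , d≗s = o , o∈ , s≼o , fo , no-increment
    where
      above? : ∀ o → Dec (_≼_ I s o × Feasible I o)
      above? o = ≼? I s o ×-dec feasible? I o

      candidates : List (Sol I)
      candidates = filter above? (allVecs I m (Wtot I))

      d-candidate : d ∈ candidates
      d-candidate = ∈-filter⁺ above? d∈ (≗⇒≼ (sym ∘ d≗s) , feasible-down (≗⇒≼ d≗s) fs)

      o : Sol I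
      o = argmax (W I) d candidates

      o-candidate : o ∈ candidates
      o-candidate with argmax-sel (W I) d candidates
      ... | inj₁ o≡d = subst (_∈ candidates) (sym o≡d) d-candidate
      ... | inj₂ o∈  = o∈

      o-facts : o ∈ allVecs I m (Wtot I) × _≼_ I s o × Feasible I o
      o-facts = ∈-filter⁻ above? {xs = allVecs I m (Wtot I)} o-candidate

      o∈ : o ∈ allVecs I m (Wtot I)
      o∈ = proj₁ o-facts

      s≼o : _≼_ I s o
      s≼o = proj₁ (proj₂ o-facts)

      fo : Feasible I o
      fo = proj₂ (proj₂ o-facts)

      -- a feasible increment of o would be a candidate of larger W
      no-increment : ∀ j → ¬ Feasible I (inc I o j)
      no-increment j f-inc =
        let q , q∈ , q≗ = enumerated f-inc
            q-candidate : q ∈ candidates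
            q-candidate = ∈-filter⁺ above? q∈ (≼-trans s≼o (≼-trans (inc-above o j) (≗⇒≼ (sym ∘ q≗))) ,
                                              feasible-down (≗⇒≼ q≗) f-inc)
        in ℕP.<⇒≱ (ℕP.<-≤-trans (W-inc o j) (∑-mono (≗⇒≼ (sym ∘ q≗))))
                  (All.lookup (f[xs]≤f[argmax] {f = W I} d candidates) q-candidate)

  M-intro : ∀ {s o} → o ∈ allVecs I m (Wtot I) → _≼_ I s o → Maximal I o → o ∈ M I s
  M-intro {s} o∈ s≼o max-o = ∈-filter⁺ (λ o → ≼? I s o ×-dec maximal? I o) o∈ (s≼o , max-o)

  M-elim : ∀ {s o} → o ∈ M I s → o ∈ allVecs I m (Wtot I) × _≼_ I s o × Maximal I o
  M-elim {s} = ∈-filter⁻ (λ o → ≼? I s o ×-dec maximal? I o) {xs = allVecs I m (Wtot I)}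

  M-nonempty : ∀ {s} → Feasible I s → ∃ λ o → o ∈ M I s
  M-nonempty fs =
    let o , o∈ , s≼o , max-o = maximal-above fs in o , M-intro o∈ s≼o max-o

  M-antitone : ∀ {s s' o} → _≼_ I s s' → o ∈ M I s' → o ∈ M I s
  M-antitone s≼s' o∈M =
    let o∈ , s'≼o , max-o = M-elim o∈M in M-intro o∈ (≼-trans s≼s' s'≼o) max-o

  G-upper : ∀ {s o} → o ∈ M I s → W I o ∸ W I s ≤ₙ G I s
  G-upper {s} = maxOf-upper (λ o → W I o ∸ W I s)

  G-antitone : ∀ {s s'} → _≼_ I s s' → G I s' ≤ₙ G I s
  G-antitone {s} {s'} s≼s' = maxOf-preserves (_≤ₙ G I s) (λ o → W I o ∸ W I s') ℕP.⊔-lub z≤n (M I s')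
    λ o o∈M → ℕP.≤-trans (ℕP.∸-monoʳ-≤ (W I o) (∑-mono s≼s')) (G-upper (M-antitone s≼s' o∈M))

  -- Moving up to a feasible solution of larger W strictly decreases G: every
  -- o ∈ M s' gains less over s' than over s, and M s' is non-empty.
  G-decrease : ∀ {s s'} → _≼_ I s s' → W I s <ₙ W I s' → Feasible I s' → G I s' <ₙ G I s
  G-decrease {s} {s'} s≼s' Ws<Ws' fs' =
    maxOf-preserves (_<ₙ G I s) (λ o → W I o ∸ W I s') ℕP.⊔-pres-<m G-positive (M I s') gain-smaller
    where
      gain-smaller : ∀ o → o ∈ M I s' → W I o ∸ W I s' <ₙ G I s
      gain-smaller o o∈M = ℕP.<-≤-trans (ℕP.∸-monoʳ-< Ws<Ws' (∑-mono (proj₁ (proj₂ (M-elim o∈M)))))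
                                        (G-upper (M-antitone s≼s' o∈M))

      G-positive : 0 <ₙ G I s
      G-positive = let o , o∈M = M-nonempty fs' in ℕP.≤-<-trans z≤n (gain-smaller o o∈M)

  load-inc : ∀ s i v → load I (inc I s i) v ≤ₙ suc (load I s v)
  load-inc s i v = ∑-bump i (λ j j≢i → ℕP.≤-reflexive (cong (λ x → if incident I v j then x else 0) (setAt-other s i _ j≢i)))
                            (subst (λ x → (if incident I v i then x else 0) ≤ₙ suc (if incident I v i then s i else 0))
                                   (sym (setAt-same s i (suc (s i)))) (mask-suc (incident I v i)))
    where
      mask-suc : ∀ b → (if b then suc (s i) else 0) ≤ₙ suc (if b then s i else 0)
      mask-suc true  = ℕP.≤-refl
      mask-suc false = z≤n

  load-inc-away : ∀ s i v → v ≢ endA i → v ≢ endB i → load I (inc I s i) v ≤ₙ load I s v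
  load-inc-away s i v v≢a v≢b = ∑-mono summand
    where
      not-incident : incident I v i ≡ false
      not-incident = cong₂ _∨_ (dec-false (v ≟ᶠ endA i) v≢a) (dec-false (v ≟ᶠ endB i) v≢b)

      summand : ∀ j → (if incident I v j then inc I s i j else 0) ≤ₙ (if incident I v j then s j else 0)
      summand j with j ≟ᶠ i
      ... | yes refl rewrite not-incident = z≤n
      ... | no _     = ℕP.≤-refl

  inc-feasible : ∀ {s} i → Feasible I s → ¬ Tight I s (endA i) → ¬ Tight I s (endB i) → Feasible I (inc I s i)
  inc-feasible {s} i fs ¬tight-a ¬tight-b v with v ≟ᶠ endA i | v ≟ᶠ endB i
  ... | yes refl | _        = ℕP.≤-trans (load-inc s i v) (ℕP.≤∧≢⇒< (fs v) ¬tight-a)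
  ... | no _     | yes refl = ℕP.≤-trans (load-inc s i v) (ℕP.≤∧≢⇒< (fs v) ¬tight-b)
  ... | no v≢a   | no v≢b   = ℕP.≤-trans (load-inc-away s i v v≢a v≢b) (fs v)

  select-accepts : ∀ {s s'} → fitness I s < fitness I s' → select I s s' ≡ s'
  select-accepts {s} {s'} improves = cong (λ b → if b then s' else s) (dec-true (fitness I s <? fitness I s') improves)

  select-rejects : ∀ {s s'} → ¬ fitness I s < fitness I s' → select I s s' ≡ s
  select-rejects {s} {s'} ¬improves = cong (λ b → if b then s' else s) (dec-false (fitness I s <? fitness I s') ¬improves)

  select-G : ∀ {s s'} → _≼_ I s s' → G I (select I s s') ≤ₙ G I s
  select-G {s} {s'} s≼s' = by-outcome (fitness I s <? fitness I s')
    where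
      by-outcome : Dec (fitness I s < fitness I s') → G I (select I s s') ≤ₙ G I s
      by-outcome (yes improves) = subst (λ r → G I r ≤ₙ G I s) (sym (select-accepts improves)) (G-antitone s≼s')
      by-outcome (no ¬improves) = ℕP.≤-reflexive (cong (G I) (select-rejects ¬improves))

  dec-rejected : ∀ {s} i → Feasible I s → select I s (dec I s i) ≡ s
  dec-rejected {s} i fs = select-rejects (ℤP.≤⇒≯ (fitness-mono (dec-below s i) fs))

  uncovered-inc : ∀ {s} i → Feasible I s → ¬ Tight I s (endA i) → ¬ Tight I s (endB i) →
                  G I (select I s (inc I s i)) <ₙ G I s
  uncovered-inc {s} i fs ¬tight-a ¬tight-b =
    subst (λ r → G I r <ₙ G I s) (sym (select-accepts (fitness-mono-< (inc-above s i) f-inc (W-inc s i))))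
          (G-decrease (inc-above s i) (W-inc s i) f-inc)
    where
      f-inc : Feasible I (inc I s i)
      f-inc = inc-feasible i fs ¬tight-a ¬tight-b

  uncoveredAt : Sol I → Fin m → ℕ
  uncoveredAt s j = if does (tight? I s (endA j)) ∨ does (tight? I s (endB j)) then 0 else 1

  edgeDrift : Sol I → Fin m → ℤ
  edgeDrift s i = (+ G I s ℤ.- + G I (select I s (inc I s i))) ℤ.+ (+ G I s ℤ.- + G I (select I s (dec I s i)))

  edge-drift : ∀ {s} → Feasible I s → ∀ i → + uncoveredAt s i ≤ edgeDrift s i
  edge-drift {s} fs i = begin
    + uncoveredAt s i                 ≤⟨ +≤+ inc-gain ⟩
    + (G I s ∸ G I s₊)                ≡⟨ pos-∸ (select-G (inc-above s i)) ⟨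
    + G I s ℤ.- + G I s₊              ≡⟨ ℤP.+-identityʳ _ ⟨
    (+ G I s ℤ.- + G I s₊) ℤ.+ + 0    ≡⟨ cong (λ z → (+ G I s ℤ.- + G I s₊) ℤ.+ z) (ℤP.+-inverseʳ (+ G I s)) ⟨
    (+ G I s ℤ.- + G I s₊) ℤ.+ (+ G I s ℤ.- + G I s)
                                      ≡⟨ cong (λ r → (+ G I s ℤ.- + G I s₊) ℤ.+ (+ G I s ℤ.- + G I r)) (dec-rejected i fs) ⟨
    edgeDrift s i                     ∎
    where
      open ℤP.≤-Reasoning
      s₊ : Sol I
      s₊ = select I s (inc I s i)

      inc-gain : uncoveredAt s i ≤ₙ G I s ∸ G I s₊
      inc-gain = neither-bound (tight? I s (endA i)) (tight? I s (endB i))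
                   (λ ¬tight-a ¬tight-b → ℕP.m<n⇒0<n∸m (uncovered-inc i fs ¬tight-a ¬tight-b))

lemma17 : (I : Instance) (s : Sol I) → Feasible I s →
    + uncovered I s ≤ driftSum I s
lemma17 I s fs = ∑-≤-∑ℤ (edge-drift I fs)
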